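{- For any formulae $A$ and $C$ and any derivation $f : A \Rightarrow C$ in the skew monoidal categorical calculus, there is a derivation of the sequent $A \mid\ \vdash C$ (stoup $A$, empty context) in the skew monoidal sequent calculus.
   Context: Fix a set $\mathrm{Var}$ of atoms. Formulae are generated by: every atom $X \in \mathrm{Var}$ is a formula; $\mathsf{I}$ is a formula; if $A, B$ are formulae then so is $A \otimes B$. A context $\Gamma$ is a finite list of formulae; a stoup $S$ is either empty (written $-$) or a single formula. The skew monoidal categorical calculus derives judgements $A \Rightarrow C$ ($A, C$ formulae) by the rules: $\mathrm{id}_A : A \Rightarrow A$; from $f : A \Rightarrow B$ and $g : B \Rightarrow C$ infer $g \circ f : A \Rightarrow C$; from $f : A \Rightarrow C$ and $g : B \Rightarrow D$ infer $f \otimes g : A \otimes B \Rightarrow C \otimes D$; and the axioms $\lambda_A : \mathsf{I} \otimes A \Rightarrow A$, $\rho_A : A \Rightarrow A \otimes \mathsf{I}$, $\alpha_{A,B,C} : (A \otimes B) \otimes C \Rightarrow A \otimes (B \otimes C)$. The skew monoidal sequent calculus derives sequents $S \mid \Gamma \vdash C$ (stoup $S$, context $\Gamma$, formula $C$) by the rules: (ax) $A \mid\ \vdash A$; (pass) from $A \mid \Gamma \vdash C$ infer $- \mid A, \Gamma \vdash C$; (scut) from $S \mid \Gamma \vdash A$ and $A \mid \Delta \vdash C$ infer $S \mid \Gamma, \Delta \vdash C$; (ccut) from $- \mid \Gamma \vdash A$ and $S \mid \Delta_0, A, \Delta_1 \vdash C$ infer $S \mid \Delta_0, \Gamma, \Delta_1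 \vdash C$; ($\mathsf{I}$L) from $- \mid \Gamma \vdash C$ infer $\mathsf{I} \mid \Gamma \vdash C$; ($\mathsf{I}$R) $- \mid\ \vdash \mathsf{I}$; ($\otimes$L) from $A \mid B, \Gamma \vdash C$ infer $A \otimes B \mid \Gamma \vdash C$; ($\otimes$R) from $S \mid \Gamma \vdash A$ and $- \mid \Delta \vdash B$ infer $S \mid \Gamma, \Delta \vdash A \otimes B$. -}

module Defs where

open import Data.List using (List; []; _∷_; _++_)
open import Data.Maybe using (Maybe; just; nothing)

data Fma (Var : Set) : Set where
  ` : Var → Fma Var
  I : Fma Var
  _⊗_ : Fma Var → Fma Var → Fma Var

infixr 6 _⊗_

Stp : Set → Set
Stp Var = Maybe (Fma Var)

Cxt : Set → Set
Cxt Var = List (Fma Var)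

infix 3 _⇒_ _∣_⊢_

data _⇒_ {Var : Set} : Fma Var → Fma Var → Set where
  id : {A : Fma Var} → A ⇒ A
  _∘_ : {A B C : Fma Var} → B ⇒ C → A ⇒ B → A ⇒ C
  _⊗′_ : {A B C D : Fma Var} → A ⇒ C → B ⇒ D → A ⊗ B ⇒ C ⊗ D
  λ′ : {A : Fma Var} → I ⊗ A ⇒ A
  ρ : {A : Fma Var} → A ⇒ A ⊗ I
  α : {A B C : Fma Var} → (A ⊗ B) ⊗ C ⇒ A ⊗ (B ⊗ C)

data _∣_⊢_ {Var : Set} : Stp Var → Cxt Var → Fma Var → Set where
  ax : {A : Fma Var} → just A ∣ [] ⊢ A
  pass : {Γ : Cxt Var} {A C : Fma Var} → just A ∣ Γ ⊢ C → nothing ∣ A ∷ Γ ⊢ C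
  scut : {S : Stp Var} {Γ Δ : Cxt Var} {A C : Fma Var} →
         S ∣ Γ ⊢ A → just A ∣ Δ ⊢ C → S ∣ Γ ++ Δ ⊢ C
  ccut : {S : Stp Var} {Γ Δ₀ Δ₁ : Cxt Var} {A C : Fma Var} →
         nothing ∣ Γ ⊢ A → S ∣ Δ₀ ++ A ∷ Δ₁ ⊢ C → S ∣ Δ₀ ++ Γ ++ Δ₁ ⊢ C
  IL : {Γ : Cxt Var} {C : Fma Var} → nothing ∣ Γ ⊢ C → just I ∣ Γ ⊢ C
  IR : nothing ∣ [] ⊢ I
  ⊗L : {Γ : Cxt Var} {A B C : Fma Var} → just A ∣ B ∷ Γ ⊢ C → just (A ⊗ B) ∣ Γ ⊢ C
  ⊗R : {S : Stp Var} {Γ Δ : Cxt Var} {A B : Fma Var} →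
       S ∣ Γ ⊢ A → nothing ∣ Δ ⊢ B → S ∣ Γ ++ Δ ⊢ A ⊗ B

module Submission where

open import Defs
open import Data.List using ([])
open import Data.Maybe using (just)

-- Induction on the derivation: composition is scut, and each structural map is
-- obtained by decomposing its source with the left rules and rebuilding its
-- target with the right rules.

module _ {Var : Set} where

  λ-sequent : {A : Fma Var} → just (I ⊗ A) ∣ [] ⊢ A
  λ-sequent = ⊗L (IL (pass ax))

  ρ-sequent : {A : Fma Var} → just A ∣ [] ⊢ A ⊗ I
  ρ-sequent = ⊗R ax IR

  α-sequent : {A B C : Fma Var} → just ((A ⊗ B) ⊗ C) ∣ [] ⊢ A ⊗ (B ⊗ C)
  α-sequent = ⊗L (⊗L (⊗R ax (pass (⊗R ax (pass ax)))))

  ⊗-sequent : {A B C D : Fma Var} →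
              just A ∣ [] ⊢ C → just B ∣ [] ⊢ D → just (A ⊗ B) ∣ [] ⊢ C ⊗ D
  ⊗-sequent f g = ⊗L (⊗R f (pass g))

theorem3p2 : {Var : Set} {A C : Fma Var} → A ⇒ C → just A ∣ [] ⊢ C
theorem3p2 id = ax
theorem3p2 (g ∘ f) = scut (theorem3p2 f) (theorem3p2 g)
theorem3p2 (f ⊗′ g) = ⊗-sequent (theorem3p2 f) (theorem3p2 g)
theorem3p2 λ′ = λ-sequent
theorem3p2 ρ = ρ-sequent
theorem3p2 α = α-sequent
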